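{- There exist a finite undirected graph $G=(V,E)$, distinct vertices $s,t\in V$, non-negative edge weights $w_e$, non-negative edge costs $c_e$ and a budget $T\ge 0$ for which the optimal value of the Budget-Constrained Minimum $s$-$t$ Cut Problem differs from the optimal value of the integral Budget-Constrained Maximum $s$-$t$ Flow Problem.
   Context: For $S\subseteq V$, $\delta(S)$ is the set of edges with exactly one endpoint in $S$. The Budget-Constrained Minimum $s$-$t$ Cut Problem: minimize $\sum_{e\in\delta(S)}w_e$ over $S\subseteq V$ with $s\in S$, $t\notin S$ and $\sum_{e\in\delta(S)}c_e\le T$. The integral Budget-Constrained Maximum $s$-$t$ Flow Problem: maximize $F$ over variables $F$, $f_{ij},f_{ji}\ge 0$ for each edge $\{i,j\}\in E$ (flow in each direction) and binary $x_{ij}\in\{0,1\}$ for each edge, subject to: the net flow leaving $s$ equals $F$, the net flow entering $t$ equals $F$, flow conservation (inflow equals outflow) at every $i\in V\setminus\{s,t\}$, $f_{ij}\le w_{ij}x_{ij}$ and $f_{ji}\le w_{ij}x_{ij}$ for every edge $\{i,j\}$ (weights act as capacities and an edge may carry flow only if $x_{ij}=1$), and $\sum_{\{i,j\}\in E}c_{ij}x_{ij}\le T$. -}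

module Defs where

open import Data.Nat using (ℕ; zero; suc)
open import Data.Fin using (Fin; zero; suc; _≟_)
open import Data.Bool using (Bool; true; false; if_then_else_; _xor_)
open import Data.Product using (_×_; _,_; proj₁; proj₂; Σ; ∃; ∃-syntax)
open import Data.Sum using (_⊎_)
open import Relation.Nullary using (¬_; does)
open import Relation.Binary.PropositionalEquality using (_≡_; _≢_)
open import Data.Rational using (ℚ; 0ℚ; _+_; _-_; _*_; _≤_; -_)

sumFin : (m : ℕ) → (Fin m → ℚ) → ℚ
sumFin zero    f = 0ℚ
sumFin (suc m) f = f zero + sumFin m (λ i → f (suc i))

[_]ℚ : Bool → ℚ
[ b ]ℚ = if b then Data.Rational.1ℚ else 0ℚ

record Instance : Set where
  field
    n m   : ℕ
    ends  : Fin m → Fin n × Fin n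
    w c   : Fin m → ℚ
    T     : ℚ
    s t   : Fin n

open Instance public

tail : (I : Instance) → Fin (m I) → Fin (n I)
tail I e = proj₁ (ends I e)

head : (I : Instance) → Fin (m I) → Fin (n I)
head I e = proj₂ (ends I e)

SameEdge : (I : Instance) → Fin (m I) → Fin (m I) → Set
SameEdge I e e' =
  (tail I e ≡ tail I e' × head I e ≡ head I e')
  ⊎ (tail I e ≡ head I e' × head I e ≡ tail I e')

ValidInstance : Instance → Set
ValidInstance I =
  ((e : Fin (m I)) → tail I e ≢ head I e)
  × ((e e' : Fin (m I)) → SameEdge I e e' → e ≡ e')
  × ((e : Fin (m I)) → 0ℚ ≤ w I e)
  × ((e : Fin (m I)) → 0ℚ ≤ c I e)
  × (0ℚ ≤ T I)
  × (s I ≢ t I)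

VSubset : Instance → Set
VSubset I = Fin (n I) → Bool

inδ : (I : Instance) → VSubset I → Fin (m I) → Bool
inδ I S e = S (tail I e) xor S (head I e)

cutWeight : (I : Instance) → VSubset I → ℚ
cutWeight I S = sumFin (m I) (λ e → [ inδ I S e ]ℚ * w I e)

cutCost : (I : Instance) → VSubset I → ℚ
cutCost I S = sumFin (m I) (λ e → [ inδ I S e ]ℚ * c I e)

FeasibleCut : (I : Instance) → VSubset I → Set
FeasibleCut I S = (S (s I) ≡ true) × (S (t I) ≡ false) × (cutCost I S ≤ T I)

IsOptCutValue : Instance → ℚ → Set
IsOptCutValue I W =
  (∃[ S ] (FeasibleCut I S × cutWeight I S ≡ W))
  × (∀ S → FeasibleCut I S → W ≤ cutWeight I S)

-- fuv e = f_{ij}, fvu e = f_{ji} for e = {i,j} with ends e = (i , j);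
-- x e ∈ {0,1} is the binary edge-selection variable.
record FlowVars (I : Instance) : Set where
  field
    F   : ℚ
    fuv : Fin (m I) → ℚ
    fvu : Fin (m I) → ℚ
    x   : Fin (m I) → Bool

open FlowVars public

isV : {k : ℕ} → Fin k → Fin k → Bool
isV i j = does (i ≟ j)

outFlow : (I : Instance) → FlowVars I → Fin (n I) → ℚ
outFlow I φ i = sumFin (m I) (λ e →
  [ isV (tail I e) i ]ℚ * fuv φ e + [ isV (head I e) i ]ℚ * fvu φ e)

inFlow : (I : Instance) → FlowVars I → Fin (n I) → ℚ
inFlow I φ i = sumFin (m I) (λ e →
  [ isV (head I e) i ]ℚ * fuv φ e + [ isV (tail I e) i ]ℚ * fvu φ e)

FeasibleFlow : (I : Instance) → FlowVars I → Set
FeasibleFlow I φ =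
  ((e : Fin (m I)) → 0ℚ ≤ fuv φ e)
  × ((e : Fin (m I)) → 0ℚ ≤ fvu φ e)
  × (outFlow I φ (s I) - inFlow I φ (s I) ≡ F φ)
  × (inFlow I φ (t I) - outFlow I φ (t I) ≡ F φ)
  × ((i : Fin (n I)) → i ≢ s I → i ≢ t I → inFlow I φ i ≡ outFlow I φ i)
  × ((e : Fin (m I)) → fuv φ e ≤ w I e * [ x φ e ]ℚ)
  × ((e : Fin (m I)) → fvu φ e ≤ w I e * [ x φ e ]ℚ)
  × (sumFin (m I) (λ e → c I e * [ x φ e ]ℚ) ≤ T I)

IsOptFlowValue : Instance → ℚ → Set
IsOptFlowValue I F* =
  (∃[ φ ] (FeasibleFlow I φ × F φ ≡ F*))
  × (∀ φ → FeasibleFlow I φ → F φ ≤ F*)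

{-# OPTIONS --safe #-}
-- On the path s — v — t with unit weights, unit costs and budget 1, deleting a
-- single edge is an affordable cut of weight 1, and every s-t cut must contain
-- an edge, so the cut optimum is 1.  A flow, however, can only use selected
-- edges, and the budget pays for just one of the two; the unselected edge
-- leaves s or t without any flowing edge, so the flow optimum is 0.
module Submission where

open import Defs
open import Data.Product using (_×_; ∃-syntax; _,_)
open import Data.Rational using (ℚ; 0ℚ; 1ℚ; _+_; _-_; _*_; _≤_; _≤?_)
open import Data.Rational.Properties
  using (≤-antisym; ≤-trans; ≤-reflexive; *-zeroˡ; *-zeroʳ; +-identityˡ)
open import Data.Nat using (ℕ)
open import Data.Fin using (Fin; zero; suc; _≟_)
open import Data.Bool using (Bool; true; false; _xor_)
open import Data.Sum using (_⊎_; inj₁; inj₂)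
open import Data.Empty using (⊥; ⊥-elim)
open import Relation.Nullary.Decidable using (from-yes; from-no; dec-false)
open import Relation.Binary.PropositionalEquality
  using (_≡_; _≢_; refl; sym; trans; cong; cong₂; subst)
open Relation.Binary.PropositionalEquality.≡-Reasoning

sumFin-zero : ∀ m (f : Fin m → ℚ) → (∀ i → f i ≡ 0ℚ) → sumFin m f ≡ 0ℚ
sumFin-zero ℕ.zero    f f≡0 = refl
sumFin-zero (ℕ.suc m) f f≡0 =
  trans (cong₂ _+_ (f≡0 zero) (sumFin-zero m _ (λ i → f≡0 (suc i)))) (+-identityˡ 0ℚ)

[isV]ℚ-≢ : ∀ {k} {i j : Fin k} → i ≢ j → [ isV i j ]ℚ ≡ 0ℚ
[isV]ℚ-≢ {i = i} {j} i≢j = cong [_]ℚ (dec-false (i ≟ j) i≢j)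

module _ (I : Instance) (φ : FlowVars I) where

  NotIncident : Fin (n I) → Fin (m I) → Set
  NotIncident i e = tail I e ≢ i × head I e ≢ i

  CarriesNoFlow : Fin (m I) → Set
  CarriesNoFlow e = fuv φ e ≡ 0ℚ × fvu φ e ≡ 0ℚ

  IdleAt : Fin (n I) → Set
  IdleAt i = ∀ e → NotIncident i e ⊎ CarriesNoFlow e

  private
    weighted-sum≡0 : ∀ p q a b → (p ≡ 0ℚ × q ≡ 0ℚ) ⊎ (a ≡ 0ℚ × b ≡ 0ℚ) → p * a + q * b ≡ 0ℚ
    weighted-sum≡0 _ _ a b (inj₁ (refl , refl)) =
      trans (cong₂ _+_ (*-zeroˡ a) (*-zeroˡ b)) (+-identityˡ 0ℚ)
    weighted-sum≡0 p q _ _ (inj₂ (refl , refl)) =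
      trans (cong₂ _+_ (*-zeroʳ p) (*-zeroʳ q)) (+-identityˡ 0ℚ)

  outFlow-idle : ∀ {i} → IdleAt i → outFlow I φ i ≡ 0ℚ
  outFlow-idle idle = sumFin-zero (m I) _ λ e → weighted-sum≡0 _ _ _ _ (term e (idle e))
    where
    term : ∀ {i} e → NotIncident i e ⊎ CarriesNoFlow e →
           ([ isV (tail I e) i ]ℚ ≡ 0ℚ × [ isV (head I e) i ]ℚ ≡ 0ℚ) ⊎ CarriesNoFlow e
    term e (inj₁ (tl , hd)) = inj₁ ([isV]ℚ-≢ tl , [isV]ℚ-≢ hd)
    term e (inj₂ none)      = inj₂ none

  inFlow-idle : ∀ {i} → IdleAt i → inFlow I φ i ≡ 0ℚ
  inFlow-idle idle = sumFin-zero (m I) _ λ e → weighted-sum≡0 _ _ _ _ (term e (idle e))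
    where
    term : ∀ {i} e → NotIncident i e ⊎ CarriesNoFlow e →
           ([ isV (head I e) i ]ℚ ≡ 0ℚ × [ isV (tail I e) i ]ℚ ≡ 0ℚ) ⊎ CarriesNoFlow e
    term e (inj₁ (tl , hd)) = inj₁ ([isV]ℚ-≢ hd , [isV]ℚ-≢ tl)
    term e (inj₂ none)      = inj₂ none

  module _ (feasible : FeasibleFlow I φ) where

    private
      capacity-unselected : ∀ {e q} → x φ e ≡ false → 0ℚ ≤ q → q ≤ w I e * [ x φ e ]ℚ → q ≡ 0ℚ
      capacity-unselected {e} x≡false 0≤q q≤cap = ≤-antisym
        (≤-trans q≤cap (≤-reflexive (trans (cong (λ b → w I e * [ b ]ℚ) x≡false) (*-zeroʳ (w I e)))))
        0≤q

    unselected⇒no-flow : ∀ {e} → x φ e ≡ false → CarriesNoFlow e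
    unselected⇒no-flow {e} x≡false =
      let (fuv≥0 , fvu≥0 , _ , _ , _ , fuv≤cap , fvu≤cap , _) = feasible
      in  capacity-unselected x≡false (fuv≥0 e) (fuv≤cap e)
        , capacity-unselected x≡false (fvu≥0 e) (fvu≤cap e)

    value≡0-if-source-idle : IdleAt (s I) → F φ ≡ 0ℚ
    value≡0-if-source-idle idle = let (_ , _ , net-out , _) = feasible in begin
      F φ                                    ≡⟨ sym net-out ⟩
      outFlow I φ (s I) - inFlow I φ (s I)   ≡⟨ cong₂ _-_ (outFlow-idle idle) (inFlow-idle idle) ⟩
      0ℚ - 0ℚ                                ≡⟨⟩
      0ℚ                                     ∎

    value≡0-if-sink-idle : IdleAt (t I) → F φ ≡ 0ℚ
    value≡0-if-sink-idle idle = let (_ , _ , _ , net-in , _) = feasible in begin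
      F φ                                    ≡⟨ sym net-in ⟩
      inFlow I φ (t I) - outFlow I φ (t I)   ≡⟨ cong₂ _-_ (inFlow-idle idle) (outFlow-idle idle) ⟩
      0ℚ - 0ℚ                                ≡⟨⟩
      0ℚ                                     ∎

pattern vs = zero
pattern vv = suc zero
pattern vt = suc (suc zero)
pattern e-sv = zero
pattern e-vt = suc zero

path-ends : Fin 2 → Fin 3 × Fin 3
path-ends e-sv = vs , vv
path-ends e-vt = vv , vt

path : Instance
path = record
  { n = 3 ; m = 2 ; ends = path-ends
  ; w = λ _ → 1ℚ ; c = λ _ → 1ℚ ; T = 1ℚ ; s = vs ; t = vt }

path-valid : ValidInstance path
path-valid = no-loops , simple , (λ _ → 0≤1) , (λ _ → 0≤1) , 0≤1 , (λ ())
  where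
  0≤1 : 0ℚ ≤ 1ℚ
  0≤1 = from-yes (0ℚ ≤? 1ℚ)
  no-loops : (e : Fin 2) → tail path e ≢ head path e
  no-loops e-sv ()
  no-loops e-vt ()
  simple : (e e' : Fin 2) → SameEdge path e e' → e ≡ e'
  simple e-sv e-sv _               = refl
  simple e-vt e-vt _               = refl
  simple e-sv e-vt (inj₁ (() , _))
  simple e-sv e-vt (inj₂ (() , _))
  simple e-vt e-sv (inj₁ (() , _))
  simple e-vt e-sv (inj₂ (_ , ()))

path-cut-optimum : IsOptCutValue path 1ℚ
path-cut-optimum = (cut-at-s , (refl , refl , from-yes (1ℚ ≤? 1ℚ)) , refl) , every-cut-≥1
  where
  cut-at-s : VSubset path
  cut-at-s vs = true
  cut-at-s _  = false
  separated-≥1 : (a b c : Bool) → a ≡ true → c ≡ false →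
                 1ℚ ≤ [ a xor b ]ℚ * 1ℚ + ([ b xor c ]ℚ * 1ℚ + 0ℚ)
  separated-≥1 true true  false refl refl = from-yes (1ℚ ≤? 1ℚ)
  separated-≥1 true false false refl refl = from-yes (1ℚ ≤? 1ℚ)
  every-cut-≥1 : ∀ S → FeasibleCut path S → 1ℚ ≤ cutWeight path S
  every-cut-≥1 S (s∈S , t∉S , _) = separated-≥1 (S vs) (S vv) (S vt) s∈S t∉S

path-budget-excludes-both : (φ : FlowVars path) → FeasibleFlow path φ →
                            x φ e-sv ≡ true → x φ e-vt ≡ true → ⊥
path-budget-excludes-both φ (_ , _ , _ , _ , _ , _ , _ , within-budget) sv-on vt-on =
  from-no (1ℚ * 1ℚ + (1ℚ * 1ℚ + 0ℚ) ≤? 1ℚ) cost-2≤1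
  where
  cost-2≤1 : 1ℚ * 1ℚ + (1ℚ * 1ℚ + 0ℚ) ≤ 1ℚ
  cost-2≤1 = subst (λ b → 1ℚ * [ b ]ℚ + (1ℚ * 1ℚ + 0ℚ) ≤ 1ℚ) sv-on
               (subst (λ b → 1ℚ * [ x φ e-sv ]ℚ + (1ℚ * [ b ]ℚ + 0ℚ) ≤ 1ℚ) vt-on within-budget)

path-zero-flow : FlowVars path
path-zero-flow = record { F = 0ℚ ; fuv = λ _ → 0ℚ ; fvu = λ _ → 0ℚ ; x = λ _ → false }

path-zero-flow-feasible : FeasibleFlow path path-zero-flow
path-zero-flow-feasible =
  (λ _ → 0≤0) , (λ _ → 0≤0) , refl , refl , conservation
  , (λ { e-sv → 0≤0 ; e-vt → 0≤0 }) , (λ { e-sv → 0≤0 ; e-vt → 0≤0 })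
  , from-yes (0ℚ ≤? 1ℚ)
  where
  0≤0 : 0ℚ ≤ 0ℚ
  0≤0 = from-yes (0ℚ ≤? 0ℚ)
  conservation : (i : Fin 3) → i ≢ vs → i ≢ vt →
                 inFlow path path-zero-flow i ≡ outFlow path path-zero-flow i
  conservation vs i≢s _ = ⊥-elim (i≢s refl)
  conservation vv _   _ = refl
  conservation vt _ i≢t = ⊥-elim (i≢t refl)

path-flow-≤0 : ∀ φ → FeasibleFlow path φ → F φ ≤ 0ℚ
path-flow-≤0 φ feasible = by-selection (x φ e-sv) (x φ e-vt) refl refl
  where
  source-idle : x φ e-sv ≡ false → IdleAt path φ vs
  source-idle sv-off e-sv = inj₂ (unselected⇒no-flow path φ feasible sv-off)
  source-idle sv-off e-vt = inj₁ ((λ ()) , (λ ()))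
  sink-idle : x φ e-vt ≡ false → IdleAt path φ vt
  sink-idle vt-off e-sv = inj₁ ((λ ()) , (λ ()))
  sink-idle vt-off e-vt = inj₂ (unselected⇒no-flow path φ feasible vt-off)
  by-selection : ∀ a b → x φ e-sv ≡ a → x φ e-vt ≡ b → F φ ≤ 0ℚ
  by-selection false _     sv-off _      =
    ≤-reflexive (value≡0-if-source-idle path φ feasible (source-idle sv-off))
  by-selection true  false _      vt-off =
    ≤-reflexive (value≡0-if-sink-idle path φ feasible (sink-idle vt-off))
  by-selection true  true  sv-on  vt-on  =
    ⊥-elim (path-budget-excludes-both φ feasible sv-on vt-on)

path-flow-optimum : IsOptFlowValue path 0ℚ
path-flow-optimum = (path-zero-flow , path-zero-flow-feasible , refl) , path-flow-≤0

mainTheorem8 : ∃[ I ] (ValidInstance I × ∃[ W ] ∃[ F* ] (IsOptCutValue I W × IsOptFlowValue I F* × W ≢ F*))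
mainTheorem8 = path , path-valid , 1ℚ , 0ℚ , path-cut-optimum , path-flow-optimum , λ ()
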